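{- Let $\ell$ be an integer with $15<\ell<\omega$, and let ${}^\ell 2$ denote the set of all $0$–$1$ sequences of length $\ell$. Suppose that $h:[{}^\ell 2]^2\longrightarrow \{0,1\}$ is a coloring of the unordered pairs of distinct elements of ${}^\ell 2$ with the property that whenever $a,b,c\in {}^\ell 2$ are pairwise distinct, then $h(a,b)=1$ or $h(a,c)=1$ or $h(b,c)=1$ (i.e., there is no triangle all of whose pairs have color $0$). Then there is a set $\mathcal{A}\subseteq {}^\ell 2$ such that (1) $|\mathcal{A}|\geq 5$ and $\mathcal{A}$ contains a 4-arrangement (i.e., there are $a,b,c,d\in\mathcal{A}$ such that $\langle a,b,c,d\rangle$ is a 4-arrangement in ${}^\ell 2$), and (2) $h(a,b)=1$ for all distinct $a,b\in\mathcal{A}$.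
   Context: $<_{\rm lex}$ denotes the lexicographic order on ${}^\ell 2$. For $1<\ell<\omega$, a 4-arrangement in ${}^\ell 2$ is a tuple $\langle a,b,c,d\rangle$ of elements of ${}^\ell 2$ such that $a<_{\rm lex} b<_{\rm lex} c<_{\rm lex} d$ and $\min\{k<\ell:a(k)\neq c(k)\}=\min\{k<\ell:b(k)\neq c(k)\}=\min\{k<\ell:a(k)\neq d(k)\}=\min\{k<\ell:b(k)\neq d(k)\}$. -}

module Defs where

open import Data.Nat using (ℕ; zero; suc; _<_)
open import Data.Bool using (Bool; true; false)
open import Data.Fin using (Fin; toℕ)
open import Data.Vec using (Vec; lookup)
open import Data.List using (List; length)
open import Data.Product using (Σ; ∃; _×_; _,_)
open import Relation.Binary.PropositionalEquality using (_≡_; _≢_)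

-- ^ℓ 2 : 0–1 sequences of length ℓ, with 0 = false, 1 = true
Seq : ℕ → Set
Seq ℓ = Vec Bool ℓ

FirstDiff : ∀ {ℓ} → Fin ℓ → Seq ℓ → Seq ℓ → Set
FirstDiff {ℓ} k a c =
  (lookup a k ≢ lookup c k) ×
  (∀ (j : Fin ℓ) → toℕ j < toℕ k → lookup a j ≡ lookup c j)

_<lex_ : ∀ {ℓ} → Seq ℓ → Seq ℓ → Set
_<lex_ {ℓ} a b = Σ (Fin ℓ) λ k → FirstDiff k a b × (lookup a k ≡ false) × (lookup b k ≡ true)

FourArrangement : ∀ {ℓ} → Seq ℓ → Seq ℓ → Seq ℓ → Seq ℓ → Set
FourArrangement {ℓ} a b c d =
  (a <lex b) × (b <lex c) × (c <lex d) ×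
  Σ (Fin ℓ) λ k → FirstDiff k a c × FirstDiff k b c × FirstDiff k a d × FirstDiff k b d

-- A colouring of pairs with no colour-0 triangle has, among any triangular k = 1 + … + k points,
-- a colour-1 clique of size k: pick a point v; the points joined to v by colour 0 form a clique,
-- so either they are at least k, or at least triangular (k - 1) points are joined to v by
-- colour 1 and we recurse among them.  Since triangular (ℓ + 2) ≤ 2 ^ ℓ for ℓ ≥ 5, this yields a
-- colour-1 clique of ℓ + 2 sequences.  Any ℓ + 2 distinct sequences of length ℓ contain a 4-arrangement: split them by their first bit; if each
-- half has two elements, two from each half form a 4-arrangement branching at the root, and
-- otherwise one half has ℓ + 1 elements, which are ℓ + 1 sequences of length ℓ - 1.
module Submission where

open import Defs
open import Data.Nat using (ℕ; _<_; _≤_)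
open import Data.Bool using (Bool; true; false)
open import Data.List using (List; length)
open import Data.List.Membership.Propositional using (_∈_)
open import Data.List.Relation.Unary.Unique.Propositional using (Unique)
open import Data.Product using (Σ; _×_; _,_)
open import Data.Sum using (_⊎_)
open import Relation.Binary.PropositionalEquality using (_≡_; _≢_)

open import Function using (_∘_)
open import Data.Product using (proj₂)
open import Data.Empty using (⊥-elim)
open import Data.Nat using (zero; suc; _+_; _∸_; _^_; z≤n; s≤s; _≤?_)
open import Data.Nat.Properties hiding (_≟_)
open import Data.Bool using (_≟_)
open import Data.Fin using (Fin; zero; suc)
open import Data.Vec using ([]; _∷_)
import Data.Vec.Properties as Vec
open import Data.List using ([]; _∷_; [_]; map; _++_; filter)
open import Data.List.Properties using (length-++; length-map)
open import Data.List.Membership.Propositional.Properties using (∈-filter⁻; ∈-map⁻)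
open import Data.List.Relation.Binary.Subset.Propositional using (_⊆_)
open import Data.List.Relation.Binary.Disjoint.Propositional using (Disjoint)
open import Data.List.Relation.Binary.Subset.Propositional.Properties using (filter-⊆)
open import Data.List.Relation.Unary.All as All using (All; []; _∷_)
open import Data.List.Relation.Unary.AllPairs using ([]; _∷_)
open import Data.List.Relation.Unary.Any using (here; there)
import Data.List.Relation.Unary.Unique.Propositional.Properties as Unique
open import Data.Sum using (inj₁; inj₂)
import Data.Sum as Sum
open import Relation.Nullary using (yes; no; does)
open import Relation.Unary using (Decidable)
open import Relation.Unary.Properties using (∁?)
open import Relation.Binary.PropositionalEquality using (refl; sym; trans; cong; cong₂; subst; module ≡-Reasoning)

triangular : ℕ → ℕ
triangular zero    = 0
triangular (suc k) = suc k + triangular k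

length-filter-∁ : ∀ {A : Set} {P : A → Set} (P? : Decidable P) (xs : List A) →
  length (filter P? xs) + length (filter (∁? P?) xs) ≡ length xs
length-filter-∁ P? [] = refl
length-filter-∁ P? (x ∷ xs) with does (P? x)
... | true  = cong suc (length-filter-∁ P? xs)
... | false = trans (+-suc _ _) (cong suc (length-filter-∁ P? xs))

module _ {S : Set} (h : S → S → Bool) where

  SymmetricOnDistinct : Set
  SymmetricOnDistinct = ∀ a b → a ≢ b → h a b ≡ h b a

  NoIndependentTriple : Set
  NoIndependentTriple = ∀ a b c → a ≢ b → a ≢ c → b ≢ c →
    (h a b ≡ true) ⊎ (h a c ≡ true) ⊎ (h b c ≡ true)

  Clique : List S → Set
  Clique ys = ∀ a b → a ∈ ys → b ∈ ys → a ≢ b → h a b ≡ true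

  adjacent? : (v : S) → Decidable (λ x → h v x ≡ true)
  adjacent? v x = h v x ≟ true

  Clique-∷ : SymmetricOnDistinct → ∀ {v ys} →
    All (λ y → h v y ≡ true) ys → Clique ys → Clique (v ∷ ys)
  Clique-∷ sym-h v~ys ys-clique a b (here refl) (here refl) a≢b = ⊥-elim (a≢b refl)
  Clique-∷ sym-h v~ys ys-clique a b (here refl) (there b∈ys) a≢b = All.lookup v~ys b∈ys
  Clique-∷ sym-h v~ys ys-clique a b (there a∈ys) (here refl) a≢b =
    trans (sym-h a b a≢b) (All.lookup v~ys a∈ys)
  Clique-∷ sym-h v~ys ys-clique a b (there a∈ys) (there b∈ys) a≢b = ys-clique a b a∈ys b∈ys a≢b

  non-neighbours-clique : NoIndependentTriple → ∀ {v xs} → All (v ≢_) xs →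
    Clique (filter (∁? (adjacent? v)) xs)
  non-neighbours-clique no-triple {v} v∉xs a b a∈ b∈ a≢b
    with ∈-filter⁻ (∁? (adjacent? v)) a∈ | ∈-filter⁻ (∁? (adjacent? v)) b∈
  ... | a∈xs , v≁a | b∈xs , v≁b
    with no-triple v a b (All.lookup v∉xs a∈xs) (All.lookup v∉xs b∈xs) a≢b
  ... | inj₁ v~a        = ⊥-elim (v≁a v~a)
  ... | inj₂ (inj₁ v~b) = ⊥-elim (v≁b v~b)
  ... | inj₂ (inj₂ a~b) = a~b

  clique-of-size : SymmetricOnDistinct → NoIndependentTriple →
    ∀ k xs → Unique xs → triangular k ≤ length xs →
    Σ (List S) λ ys → ys ⊆ xs × Unique ys × k ≤ length ys × Clique ys
  clique-of-size sym-h no-triple zero xs xs! _ = [] , (λ ()) , [] , z≤n , λ _ _ ()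
  clique-of-size sym-h no-triple (suc k) (v ∷ rest) (v∉rest ∷ rest!) (s≤s size)
    with suc k ≤? length (filter (∁? (adjacent? v)) rest)
  ... | yes many =
    filter (∁? (adjacent? v)) rest , there ∘ filter-⊆ _ rest ,
    Unique.filter⁺ _ rest! , many , non-neighbours-clique no-triple v∉rest
  ... | no few
    with clique-of-size sym-h no-triple k (filter (adjacent? v) rest)
           (Unique.filter⁺ _ rest!) (neighbours-many (≤-pred (≰⇒> few)))
    where
    neighbours-many : length (filter (∁? (adjacent? v)) rest) ≤ k →
      triangular k ≤ length (filter (adjacent? v) rest)
    neighbours-many few = +-cancelʳ-≤ k _ _ (begin
      triangular k + k                   ≡⟨ +-comm (triangular k) k ⟩
      k + triangular k                   ≤⟨ size ⟩
      length rest                        ≡⟨ sym (length-filter-∁ (adjacent? v) rest) ⟩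
      length (filter (adjacent? v) rest)
        + length (filter (∁? (adjacent? v)) rest) ≤⟨ +-monoʳ-≤ _ few ⟩
      length (filter (adjacent? v) rest) + k ∎)
      where open ≤-Reasoning
  ... | ys , ys⊆ , ys! , k≤ys , ys-clique =
    v ∷ ys , (λ { (here refl) → here refl ; (there y∈ys) → there (in-rest y∈ys) }) ,
    All.tabulate (All.lookup v∉rest ∘ in-rest) ∷ ys! , s≤s k≤ys ,
    Clique-∷ sym-h v~ys ys-clique
    where
    in-rest : ys ⊆ rest
    in-rest = filter-⊆ _ rest ∘ ys⊆

    v~ys : All (λ y → h v y ≡ true) ys
    v~ys = All.tabulate λ y∈ys → proj₂ (∈-filter⁻ (adjacent? v) {xs = rest} (ys⊆ y∈ys))

FirstDiff-∷ : ∀ {n} {k : Fin n} {a c : Seq n} (x : Bool) →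
  FirstDiff k a c → FirstDiff (suc k) (x ∷ a) (x ∷ c)
FirstDiff-∷ x (a≢c , agree) = a≢c , λ { zero _ → refl ; (suc j) (s≤s j<k) → agree j j<k }

FirstDiff-head : ∀ {n} (u v : Seq n) → FirstDiff zero (false ∷ u) (true ∷ v)
FirstDiff-head u v = (λ ()) , λ _ ()

<lex-∷ : ∀ {n} {a c : Seq n} (x : Bool) → a <lex c → (x ∷ a) <lex (x ∷ c)
<lex-∷ x (k , a≠c , a₀ , c₁) = suc k , FirstDiff-∷ x a≠c , a₀ , c₁

<lex-head : ∀ {n} (u v : Seq n) → (false ∷ u) <lex (true ∷ v)
<lex-head u v = zero , FirstDiff-head u v , refl , refl

<lex-total : ∀ {n} {u v : Seq n} → u ≢ v → (u <lex v) ⊎ (v <lex u)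
<lex-total {u = []}        {[]}         u≢v = ⊥-elim (u≢v refl)
<lex-total {u = false ∷ u} {true ∷ v}   _   = inj₁ (<lex-head u v)
<lex-total {u = true ∷ u}  {false ∷ v}  _   = inj₂ (<lex-head v u)
<lex-total {u = false ∷ u} {false ∷ v}  u≢v =
  Sum.map (<lex-∷ false) (<lex-∷ false) (<lex-total (u≢v ∘ cong (false ∷_)))
<lex-total {u = true ∷ u}  {true ∷ v}   u≢v =
  Sum.map (<lex-∷ true) (<lex-∷ true) (<lex-total (u≢v ∘ cong (true ∷_)))

FourArrangement-∷ : ∀ {n} {a b c d : Seq n} (x : Bool) → FourArrangement a b c d →
  FourArrangement (x ∷ a) (x ∷ b) (x ∷ c) (x ∷ d)
FourArrangement-∷ x (a<b , b<c , c<d , k , a≠c , b≠c , a≠d , b≠d) =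
  <lex-∷ x a<b , <lex-∷ x b<c , <lex-∷ x c<d ,
  suc k , FirstDiff-∷ x a≠c , FirstDiff-∷ x b≠c , FirstDiff-∷ x a≠d , FirstDiff-∷ x b≠d

FourArrangement-head : ∀ {n} {a b c d : Seq n} → a <lex b → c <lex d →
  FourArrangement (false ∷ a) (false ∷ b) (true ∷ c) (true ∷ d)
FourArrangement-head {a = a} {b} {c} {d} a<b c<d =
  <lex-∷ false a<b , <lex-head b c , <lex-∷ true c<d ,
  zero , FirstDiff-head a c , FirstDiff-head b c , FirstDiff-head a d , FirstDiff-head b d

OrderedPair : ∀ {n} → List (Seq n) → Set
OrderedPair {n} xs = Σ (Seq n) λ a → Σ (Seq n) λ b → (a ∈ xs) × (b ∈ xs) × (a <lex b)

HasFourArrangement : ∀ {n} → List (Seq n) → Set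
HasFourArrangement {n} xs = Σ (Seq n) λ a → Σ (Seq n) λ b → Σ (Seq n) λ c → Σ (Seq n) λ d →
  (a ∈ xs) × (b ∈ xs) × (c ∈ xs) × (d ∈ xs) × FourArrangement a b c d

orderedPair : ∀ {n} {xs : List (Seq n)} → Unique xs → 2 ≤ length xs → OrderedPair xs
orderedPair {xs = _ ∷ []} _ (s≤s ())
orderedPair {xs = u ∷ v ∷ _} ((u≢v ∷ _) ∷ _) _ with <lex-total u≢v
... | inj₁ u<v = u , v , here refl , there (here refl) , u<v
... | inj₂ v<u = v , u , there (here refl) , here refl , v<u

branch : ∀ {n} → Bool → List (Seq (suc n)) → List (Seq n)
branch b [] = []
branch b ((x ∷ v) ∷ xs) with x ≟ b
... | yes _ = v ∷ branch b xs
... | no _  = branch b xs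

branch-∈ : ∀ {n} b (xs : List (Seq (suc n))) {v} → v ∈ branch b xs → (b ∷ v) ∈ xs
branch-∈ b ((x ∷ w) ∷ xs) v∈ with x ≟ b | v∈
... | yes refl | here refl = here refl
... | yes refl | there v∈′ = there (branch-∈ b xs v∈′)
... | no _     | v∈′       = there (branch-∈ b xs v∈′)

branch-All : ∀ {n} {P : Seq (suc n) → Set} b {xs : List (Seq (suc n))} →
  All P xs → All (P ∘ (b ∷_)) (branch b xs)
branch-All b [] = []
branch-All b {(x ∷ v) ∷ xs} (px ∷ pxs) with x ≟ b
... | yes refl = px ∷ branch-All b pxs
... | no _     = branch-All b pxs

branch-unique : ∀ {n} b {xs : List (Seq (suc n))} → Unique xs → Unique (branch b xs)
branch-unique b [] = []
branch-unique b {(x ∷ v) ∷ xs} (v∉xs ∷ xs!) with x ≟ b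
... | yes refl = All.map (_∘ cong (b ∷_)) (branch-All b v∉xs) ∷ branch-unique b xs!
... | no _     = branch-unique b xs!

length-branch : ∀ {n} (xs : List (Seq (suc n))) →
  length (branch false xs) + length (branch true xs) ≡ length xs
length-branch [] = refl
length-branch ((false ∷ v) ∷ xs) = cong suc (length-branch xs)
length-branch ((true ∷ v) ∷ xs)  = trans (+-suc _ _) (cong suc (length-branch xs))

HasFourArrangement-branch : ∀ {n} b (xs : List (Seq (suc n))) →
  HasFourArrangement (branch b xs) → HasFourArrangement xs
HasFourArrangement-branch x xs (a , b , c , d , a∈ , b∈ , c∈ , d∈ , arr) =
  x ∷ a , x ∷ b , x ∷ c , x ∷ d ,
  branch-∈ x xs a∈ , branch-∈ x xs b∈ , branch-∈ x xs c∈ , branch-∈ x xs d∈ , FourArrangement-∷ x arr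

HasFourArrangement-across : ∀ {n} (xs : List (Seq (suc n))) →
  OrderedPair (branch false xs) → OrderedPair (branch true xs) → HasFourArrangement xs
HasFourArrangement-across xs (a , b , a∈ , b∈ , a<b) (c , d , c∈ , d∈ , c<d) =
  false ∷ a , false ∷ b , true ∷ c , true ∷ d ,
  branch-∈ false xs a∈ , branch-∈ false xs b∈ , branch-∈ true xs c∈ , branch-∈ true xs d∈ ,
  FourArrangement-head a<b c<d

m≤1⇒1+k≤m+o⇒k≤o : ∀ {m o k} → m ≤ 1 → suc k ≤ m + o → k ≤ o
m≤1⇒1+k≤m+o⇒k≤o {o = o} m≤1 k<m+o = ≤-pred (≤-trans k<m+o (+-monoˡ-≤ o m≤1))

fourArrangement-among : ∀ n (xs : List (Seq n)) → Unique xs → 2 + n ≤ length xs →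
  HasFourArrangement xs
fourArrangement-among zero xs xs! size with orderedPair xs! size
... | _ , _ , _ , _ , () , _
fourArrangement-among (suc n) xs xs! size =
  fromBranches (subst (3 + n ≤_) (sym (length-branch xs)) size)
  where
  fromBranches : 3 + n ≤ length (branch false xs) + length (branch true xs) →
    HasFourArrangement xs
  fromBranches size′ with length (branch false xs) ≤? 1 | length (branch true xs) ≤? 1
  ... | yes few₀ | _ =
    HasFourArrangement-branch true xs (fourArrangement-among n (branch true xs)
      (branch-unique true xs!) (m≤1⇒1+k≤m+o⇒k≤o few₀ size′))
  ... | no _     | yes few₁ =
    HasFourArrangement-branch false xs (fourArrangement-among n (branch false xs)
      (branch-unique false xs!)
      (m≤1⇒1+k≤m+o⇒k≤o few₁ (subst (3 + n ≤_) (+-comm (length (branch false xs)) _) size′)))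
  ... | no many₀ | no many₁ =
    HasFourArrangement-across xs (orderedPair (branch-unique false xs!) (≰⇒> many₀))
      (orderedPair (branch-unique true xs!) (≰⇒> many₁))

allSeq : ∀ n → List (Seq n)
allSeq zero    = [ [] ]
allSeq (suc n) = map (false ∷_) (allSeq n) ++ map (true ∷_) (allSeq n)

length-allSeq : ∀ n → length (allSeq n) ≡ 2 ^ n
length-allSeq zero    = refl
length-allSeq (suc n) = begin
  length (map (false ∷_) (allSeq n) ++ map (true ∷_) (allSeq n))
    ≡⟨ length-++ (map (false ∷_) (allSeq n)) ⟩
  length (map (false ∷_) (allSeq n)) + length (map (true ∷_) (allSeq n))
    ≡⟨ cong₂ _+_ (length-map (false ∷_) (allSeq n)) (length-map (true ∷_) (allSeq n)) ⟩
  length (allSeq n) + length (allSeq n)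
    ≡⟨ cong₂ _+_ (length-allSeq n) (trans (length-allSeq n) (sym (+-identityʳ _))) ⟩
  2 ^ suc n ∎
  where open ≡-Reasoning

allSeq-unique : ∀ n → Unique (allSeq n)
allSeq-unique zero    = [] ∷ []
allSeq-unique (suc n) =
  Unique.++⁺ (Unique.map⁺ Vec.∷-injectiveʳ (allSeq-unique n))
             (Unique.map⁺ Vec.∷-injectiveʳ (allSeq-unique n)) heads-differ
  where
  heads-differ : Disjoint (map (false ∷_) (allSeq n)) (map (true ∷_) (allSeq n))
  heads-differ (v∈₀ , v∈₁) with ∈-map⁻ (false ∷_) v∈₀ | ∈-map⁻ (true ∷_) v∈₁
  ... | _ , _ , refl | _ , _ , ()

8+m≤2^[5+m] : ∀ m → 8 + m ≤ 2 ^ (5 + m)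
8+m≤2^[5+m] zero    = m≤m+n 8 24
8+m≤2^[5+m] (suc m) = begin
  1 + (8 + m)                  ≤⟨ +-mono-≤ (m^n>0 2 (5 + m)) (8+m≤2^[5+m] m) ⟩
  2 ^ (5 + m) + 2 ^ (5 + m)    ≡⟨ cong (2 ^ (5 + m) +_) (sym (+-identityʳ _)) ⟩
  2 ^ (6 + m)                  ∎
  where open ≤-Reasoning

triangular[7+m]≤2^[5+m] : ∀ m → triangular (7 + m) ≤ 2 ^ (5 + m)
triangular[7+m]≤2^[5+m] zero    = m≤m+n 28 4
triangular[7+m]≤2^[5+m] (suc m) = begin
  (8 + m) + triangular (7 + m) ≤⟨ +-mono-≤ (8+m≤2^[5+m] m) (triangular[7+m]≤2^[5+m] m) ⟩
  2 ^ (5 + m) + 2 ^ (5 + m)    ≡⟨ cong (2 ^ (5 + m) +_) (sym (+-identityʳ _)) ⟩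
  2 ^ (6 + m)                  ∎
  where open ≤-Reasoning

triangular[2+n]≤2^n : ∀ {n} → 5 ≤ n → triangular (2 + n) ≤ 2 ^ n
triangular[2+n]≤2^n {n} 5≤n =
  subst (λ n → triangular (2 + n) ≤ 2 ^ n) (m+[n∸m]≡n 5≤n) (triangular[7+m]≤2^[5+m] (n ∸ 5))

cliqueWithFourArrangement : ∀ {ℓ} → 5 ≤ ℓ → (h : Seq ℓ → Seq ℓ → Bool) →
  SymmetricOnDistinct h → NoIndependentTriple h →
  Σ (List (Seq ℓ)) λ A → Unique A × 2 + ℓ ≤ length A × HasFourArrangement A × Clique h A
cliqueWithFourArrangement {ℓ} 5≤ℓ h sym-h no-triple
  with clique-of-size h sym-h no-triple (2 + ℓ) (allSeq ℓ) (allSeq-unique ℓ)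
         (subst (triangular (2 + ℓ) ≤_) (sym (length-allSeq ℓ)) (triangular[2+n]≤2^n 5≤ℓ))
... | A , _ , A! , 2+ℓ≤|A| , A-clique =
  A , A! , 2+ℓ≤|A| , fourArrangement-among ℓ A A! 2+ℓ≤|A| , A-clique

lemma2p2 : (ℓ : ℕ) → 15 < ℓ →
    (h : Seq ℓ → Seq ℓ → Bool) →
    (∀ a b → a ≢ b → h a b ≡ h b a) →
    (∀ a b c → a ≢ b → a ≢ c → b ≢ c →
      (h a b ≡ true) ⊎ (h a c ≡ true) ⊎ (h b c ≡ true)) →
    Σ (List (Seq ℓ)) λ A →
      Unique A × (5 ≤ length A) ×
      (Σ (Seq ℓ) λ a → Σ (Seq ℓ) λ b → Σ (Seq ℓ) λ c → Σ (Seq ℓ) λ d →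
        (a ∈ A) × (b ∈ A) × (c ∈ A) × (d ∈ A) × FourArrangement a b c d) ×
      (∀ a b → a ∈ A → b ∈ A → a ≢ b → h a b ≡ true)
lemma2p2 ℓ 15<ℓ h sym-h no-triple =
  let A , A! , 2+ℓ≤|A| , A-arrangement , A-clique = cliqueWithFourArrangement 5≤ℓ h sym-h no-triple
  in  A , A! , ≤-trans (m≤n⇒m≤o+n 2 5≤ℓ) 2+ℓ≤|A| , A-arrangement , A-clique
  where
  5≤ℓ : 5 ≤ ℓ
  5≤ℓ = ≤-trans (m≤m+n 5 11) 15<ℓ
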